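{- For every positive integer $n$, $q(n)-q(n-1)-q(n-2)\leqslant 0$.
   Context: $q(n)$ denotes the number of partitions of the positive integer $n$ into odd parts (equivalently, into distinct parts); $q(0)=1$ and $q(n)=0$ for negative integers $n$. -}

module Defs where

open import Data.Nat using (ℕ; zero; suc; _+_; _∸_; _≤?_)
open import Data.Nat.Properties using ()
open import Data.Bool using (Bool; true; false; if_then_else_)
open import Data.Integer using (ℤ; +_; -[1+_])
open import Relation.Nullary using (yes; no)

odd? : ℕ → Bool
odd? zero = false
odd? (suc zero) = true
odd? (suc (suc k)) = odd? k

-- partsLe n m : number of partitions of n into odd parts each ≤ m.
-- Recursion on m; for a part m that is odd, either m is not used
-- (partsLe n (m-1)) or at least one copy is used: we count the number
-- j ≥ 1 of copies of m, i.e. sum over j of partsLe (n - j*m) (m-1).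
mutual
  partsLe : ℕ → ℕ → ℕ
  partsLe zero    _       = 1
  partsLe (suc n) zero    = 0
  partsLe (suc n) (suc m) =
    if odd? (suc m) then withCopies (suc n) (suc n) (suc m) m
    else partsLe (suc n) m

  -- withCopies fuel n p m : Σ_{j ≥ 0, j*p ≤ n} partsLe (n - j*p) m, with p ≥ 1,
  -- fuel ≥ n bounding the number of steps.
  withCopies : ℕ → ℕ → ℕ → ℕ → ℕ
  withCopies zero    n p m = partsLe n m
  withCopies (suc f) n p m with p ≤? n
  ... | yes _ = partsLe n m + withCopies f (n ∸ p) p m
  ... | no  _ = partsLe n m

-- q n : number of partitions of n into odd parts (all parts are ≤ n).
q : ℕ → ℕ
q n = partsLe n n

qℤ : ℤ → ℤ
qℤ (+ n)     = + q n
qℤ -[1+ _ ] = + 0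

{-# OPTIONS --safe #-}
-- Let p m n count the partitions of n into odd parts ≤ m.  Allowing one more odd
-- part M gives p M n = p m n + p M (n − M), a relation that is linear in the
-- sequence, and so is the inequality p n ≤ p (n − 1) + p (n − 2).  By induction
-- over even m, and inside that by strong induction on n, one gets for n ≥ 1
--   p m n + [n = 2] + [n = m + 1] ≤ p m (n − 1) + p m (n − 2):
-- the slack [n = m + 1] absorbs the term p M 0 = 1 at n = M, and the slack [n = 2]
-- of p M (n − M) absorbs the new slack [n = M + 2].  Since p m n = q n once
-- m ≥ n, the theorem follows.
module Submission where

open import Defs
open import Data.Nat using (ℕ) renaming (_≤_ to _≤ℕ_)
open import Data.Integer using (+_; _-_; _≤_)

open import Data.Nat as ℕ
  using (zero; suc; _+_; _∸_; _<_; _≤?_; _<?_; z≤n; s≤s; _≤′_; ≤′-refl; ≤′-step)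
import Data.Nat.Properties as ℕ
open import Data.Nat.Induction using (<-rec)
open import Algebra.Properties.CommutativeSemigroup ℕ.+-commutativeSemigroup
  using (interchange; x∙yz≈y∙xz)
import Data.Integer as ℤ
import Data.Integer.Properties as ℤ
open import Data.Bool using (true; false)
open import Data.Product using (_,_)
open import Function using (_∘_)
open import Relation.Nullary using (yes; no)
open import Relation.Binary.PropositionalEquality

shift : ℕ → (ℕ → ℕ) → ℕ → ℕ
shift zero    f n       = f n
shift (suc k) f zero    = 0
shift (suc k) f (suc n) = shift k f n

shift-< : ∀ {k n} f → n < k → shift k f n ≡ 0
shift-< {suc k} {zero}  f _         = refl
shift-< {suc k} {suc n} f (s≤s n<k) = shift-< f n<k

shift-∸ : ∀ {k n} f → k ≤ℕ n → shift k f n ≡ f (n ∸ k)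
shift-∸ {zero}          f _         = refl
shift-∸ {suc k} {suc n} f (s≤s k≤n) = shift-∸ f k≤n

shift-+ : ∀ j k f d → shift (j + k) f (j + d) ≡ shift k f d
shift-+ zero    k f d = refl
shift-+ (suc j) k f d = shift-+ j k f d

shift-cong : ∀ {f g} → (∀ x → f x ≡ g x) → ∀ k n → shift k f n ≡ shift k g n
shift-cong f≗g zero    n       = f≗g n
shift-cong f≗g (suc k) zero    = refl
shift-cong f≗g (suc k) (suc n) = shift-cong f≗g k n

shift-unfold : ∀ {f g j} → (∀ x → f x ≡ g x + shift j f x) →
               ∀ k n → shift k f n ≡ shift k g n + shift (k + j) f n
shift-unfold f≗g+f zero    n       = f≗g+f n
shift-unfold f≗g+f (suc k) zero    = refl
shift-unfold f≗g+f (suc k) (suc n) = shift-unfold f≗g+f k n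

p : ℕ → ℕ → ℕ
p m n = partsLe n m

withCopies-zero : ∀ f j m → withCopies f zero (suc j) m ≡ partsLe zero m
withCopies-zero zero    j m = refl
withCopies-zero (suc f) j m with suc j ≤? zero
... | no _ = refl

withCopies-fuel : ∀ f f' n j m → n ≤ℕ f → n ≤ℕ f' →
                  withCopies f n (suc j) m ≡ withCopies f' n (suc j) m
withCopies-fuel zero    f'       n j m z≤n _   = sym (withCopies-zero f' j m)
withCopies-fuel (suc f) zero     n j m _   z≤n = withCopies-zero (suc f) j m
withCopies-fuel (suc f) (suc f') n j m n≤f n≤f' with suc j ≤? n
... | no _  = refl
... | yes _ = cong (_+_ (partsLe n m))
                (withCopies-fuel f f' (n ∸ suc j) j m (fewer n≤f) (fewer n≤f'))
  where
  fewer : ∀ {g} → n ≤ℕ suc g → n ∸ suc j ≤ℕ g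
  fewer n≤g = ℕ.∸-mono n≤g (s≤s z≤n)

withCopies-step : ∀ f n m → n ≤ℕ suc f →
  withCopies (suc f) n (suc m) m ≡ partsLe n m + shift (suc m) (λ x → withCopies x x (suc m) m) n
withCopies-step f n m n≤1+f with suc m ≤? n
... | yes M≤n = cong (_+_ (partsLe n m))
                  (trans (withCopies-fuel f (n ∸ suc m) (n ∸ suc m) m m
                            (ℕ.∸-mono n≤1+f (s≤s z≤n)) ℕ.≤-refl)
                         (sym (shift-∸ _ M≤n)))
... | no M≰n  = sym (trans (cong (_+_ (partsLe n m)) (shift-< _ (ℕ.≰⇒> M≰n)))
                           (ℕ.+-identityʳ _))

p-suc-withCopies : ∀ m → odd? (suc m) ≡ true → ∀ n → p (suc m) n ≡ withCopies n n (suc m) m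
p-suc-withCopies m odd zero = refl
p-suc-withCopies m odd (suc n) rewrite odd = refl

p-suc-odd : ∀ m → odd? (suc m) ≡ true → ∀ n → p (suc m) n ≡ p m n + shift (suc m) (p (suc m)) n
p-suc-odd m odd zero    = refl
p-suc-odd m odd (suc n) = begin
  p (suc m) (suc n)
    ≡⟨ p-suc-withCopies m odd (suc n) ⟩
  withCopies (suc n) (suc n) (suc m) m
    ≡⟨ withCopies-step n (suc n) m ℕ.≤-refl ⟩
  p m (suc n) + shift (suc m) (λ x → withCopies x x (suc m) m) (suc n)
    ≡⟨ cong (_+_ (p m (suc n))) (shift-cong (sym ∘ p-suc-withCopies m odd) (suc m) (suc n)) ⟩
  p m (suc n) + shift (suc m) (p (suc m)) (suc n) ∎
  where open ≡-Reasoning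

p-suc-even : ∀ m → odd? (suc m) ≡ false → ∀ n → p (suc m) n ≡ p m n
p-suc-even m even zero = refl
p-suc-even m even (suc n) rewrite even = refl

p-suc-≤ : ∀ {x m} → x ≤ℕ m → p (suc m) x ≡ p m x
p-suc-≤ {x} {m} x≤m with odd? (suc m) in parity
... | true  = trans (p-suc-odd m parity x)
                    (trans (cong (_+_ (p m x)) (shift-< _ (s≤s x≤m))) (ℕ.+-identityʳ _))
... | false = p-suc-even m parity x

p-stable : ∀ {x m} → x ≤ℕ m → p m x ≡ q x
p-stable = stable′ ∘ ℕ.≤⇒≤′
  where
  stable′ : ∀ {x m} → x ≤′ m → p m x ≡ q x
  stable′ ≤′-refl      = refl
  stable′ (≤′-step x≤m) = trans (p-suc-≤ (ℕ.≤′⇒≤ x≤m)) (stable′ x≤m)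

odd?-double : ∀ k → odd? (k + k) ≡ false
odd?-double zero = refl
odd?-double (suc k) rewrite ℕ.+-suc k k = odd?-double k

odd?-suc-even : ∀ m → odd? m ≡ false → odd? (suc m) ≡ true
odd?-suc-even zero          _    = refl
odd?-suc-even (suc (suc m)) even = odd?-suc-even m even

δ : ℕ → ℕ → ℕ
δ zero    zero    = 1
δ zero    (suc b) = 0
δ (suc a) zero    = 0
δ (suc a) (suc b) = δ a b

δ-refl : ∀ a → δ a a ≡ 1
δ-refl zero    = refl
δ-refl (suc a) = δ-refl a

δ-< : ∀ {a b} → a < b → δ a b ≡ 0
δ-< {zero}  {suc b} _         = refl
δ-< {suc a} {suc b} (s≤s a<b) = δ-< a<b

δ-+ : ∀ j a b → δ (j + a) (j + b) ≡ δ a b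
δ-+ zero    a b = refl
δ-+ (suc j) a b = δ-+ j a b

correction : ℕ → ℕ → ℕ
correction c n = δ n 2 + δ n c

FibBound : (ℕ → ℕ) → ℕ → ℕ → Set
FibBound f c n = f n + correction c n ≤ℕ shift 1 f n + shift 2 f n

fibBound-cong : ∀ {f g c} → (∀ x → f x ≡ g x) → ∀ n → FibBound f c n → FibBound g c n
fibBound-cong {c = c} f≗g n =
  subst₂ _≤ℕ_ (cong (_+ correction c n) (f≗g n))
               (cong₂ _+_ (shift-cong f≗g 1 n) (shift-cong f≗g 2 n))

combine-bounds : ∀ {a₀ a₁ a₂ b₀ b₁ b₂ x y c} →
  a₀ + y ≤ℕ a₁ + a₂ → b₀ + x ≤ℕ y + c → c ≤ℕ b₁ + b₂ →
  (a₀ + b₀) + x ≤ℕ (a₁ + b₁) + (a₂ + b₂)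
combine-bounds {a₀} {a₁} {a₂} {b₀} {b₁} {b₂} {x} {y} {c} a-bound x-bound c-bound = begin
  (a₀ + b₀) + x         ≡⟨ ℕ.+-assoc a₀ b₀ x ⟩
  a₀ + (b₀ + x)         ≤⟨ ℕ.+-monoʳ-≤ a₀ x-bound ⟩
  a₀ + (y + c)          ≡⟨ ℕ.+-assoc a₀ y c ⟨
  (a₀ + y) + c          ≤⟨ ℕ.+-mono-≤ a-bound c-bound ⟩
  (a₁ + a₂) + (b₁ + b₂) ≡⟨ interchange a₁ a₂ b₁ b₂ ⟩
  (a₁ + b₁) + (a₂ + b₂) ∎
  where open ℕ.≤-Reasoning

module AddPart {f g : ℕ → ℕ} {m : ℕ}
    (f≗g+shift : ∀ x → f x ≡ g x + shift (suc m) f x)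
    (f0≤1 : f 0 ≤ℕ 1)
    (g-bound : ∀ n → FibBound g (suc m) (suc n)) where

  private
    M = suc m
    c = suc (suc M)

  from-tails : ∀ {n t} → let X = suc n in
    shift M f X + correction c X ≤ℕ correction M X + t →
    t ≤ℕ shift (1 + M) f X + shift (2 + M) f X → FibBound f c X
  from-tails {n} head-bound tail-bound = begin
    f X + correction c X
      ≡⟨ cong (_+ correction c X) (tails 0) ⟩
    (g X + shift M f X) + correction c X
      ≤⟨ combine-bounds {a₀ = g X} {shift 1 g X} {shift 2 g X}
                        {shift M f X} {shift (1 + M) f X} {shift (2 + M) f X}
                        (g-bound n) head-bound tail-bound ⟩
    (shift 1 g X + shift (1 + M) f X) + (shift 2 g X + shift (2 + M) f X)
      ≡⟨ cong₂ _+_ (tails 1) (tails 2) ⟨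
    shift 1 f X + shift 2 f X ∎
    where
    open ℕ.≤-Reasoning
    X = suc n
    tails : ∀ k → shift k f X ≡ shift k g X + shift (k + M) f X
    tails k = shift-unfold f≗g+shift k X

  below : ∀ {n} → suc n < M → FibBound f c (suc n)
  below {n} X<M = from-tails head-bound z≤n
    where
    X = suc n
    head-bound : shift M f X + correction c X ≤ℕ correction M X + 0
    head-bound = begin
      shift M f X + (δ X 2 + δ X c) ≡⟨ cong₂ (λ s t → s + (δ X 2 + t))
                                             (shift-< f X<M) (δ-< (ℕ.m<n⇒m<1+n (ℕ.m<n⇒m<1+n X<M))) ⟩
      δ X 2 + 0                     ≤⟨ ℕ.+-monoʳ-≤ (δ X 2) z≤n ⟩
      δ X 2 + δ X M                 ≤⟨ ℕ.m≤m+n _ 0 ⟩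
      (δ X 2 + δ X M) + 0           ∎
      where open ℕ.≤-Reasoning

  at-M : FibBound f c M
  at-M = from-tails head-bound z≤n
    where
    head-bound : shift M f M + correction c M ≤ℕ correction M M + 0
    head-bound = begin
      shift M f M + (δ M 2 + δ M c) ≡⟨ cong₂ (λ s t → s + (δ M 2 + t))
                                             (trans (shift-∸ {M} f ℕ.≤-refl) (cong f (ℕ.n∸n≡0 M)))
                                             (δ-< (ℕ.m<n⇒m<1+n (ℕ.n<1+n M))) ⟩
      f 0 + (δ M 2 + 0)             ≤⟨ ℕ.+-mono-≤ f0≤1 (ℕ.≤-reflexive (ℕ.+-identityʳ _)) ⟩
      1 + δ M 2                     ≡⟨ ℕ.+-comm 1 (δ M 2) ⟩
      δ M 2 + 1                     ≡⟨ cong (_+_ (δ M 2)) (δ-refl M) ⟨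
      δ M 2 + δ M M                 ≡⟨ ℕ.+-identityʳ _ ⟨
      (δ M 2 + δ M M) + 0           ∎
      where open ℕ.≤-Reasoning

  above : ∀ d → FibBound f c (suc d) → FibBound f c (M + suc d)
  above d D-bound = from-tails head-bound
    (subst (f D + correction c D ≤ℕ_) (sym (cong₂ _+_ (shifted 1) (shifted 2))) D-bound)
    where
    D = suc d
    X = M + D
    shifted : ∀ k → shift (k + M) f X ≡ shift k f D
    shifted k = trans (cong (λ i → shift i f X) (ℕ.+-comm k M)) (shift-+ M k f D)
    δ-X-c : δ X c ≡ δ D 2
    δ-X-c = trans (cong (δ X) (ℕ.+-comm 2 M)) (δ-+ M D 2)
    head-bound : shift M f X + correction c X ≤ℕ correction M X + (f D + correction c D)
    head-bound = begin
      shift M f X + (δ X 2 + δ X c) ≡⟨ cong₂ (λ s t → s + (δ X 2 + t)) (shifted 0) δ-X-c ⟩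
      f D + (δ X 2 + δ D 2)         ≡⟨ x∙yz≈y∙xz (f D) (δ X 2) (δ D 2) ⟩
      δ X 2 + (f D + δ D 2)         ≤⟨ ℕ.+-mono-≤ (ℕ.m≤m+n (δ X 2) (δ X M))
                                                  (ℕ.+-monoʳ-≤ (f D) (ℕ.m≤m+n (δ D 2) (δ D c))) ⟩
      (δ X 2 + δ X M) + (f D + (δ D 2 + δ D c)) ∎
      where open ℕ.≤-Reasoning

  fibBound : ∀ n → FibBound f c (suc n)
  fibBound = <-rec (λ n → FibBound f c (suc n)) bound
    where
    bound : ∀ n → (∀ {k} → k < n → FibBound f c (suc k)) → FibBound f c (suc n)
    bound n earlier with suc n <? M
    ... | yes X<M = below X<M
    ... | no X≮M with ℕ.m≤n⇒∃[o]m+o≡n (ℕ.≮⇒≥ X≮M)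
    ...   | zero  , M+0≡X = subst (FibBound f c) (trans (sym (ℕ.+-identityʳ M)) M+0≡X) at-M
    ...   | suc d , M+D≡X = subst (FibBound f c) M+D≡X (above d (earlier d<n))
      where
      d<n : d < n
      d<n = ℕ.≤-trans (ℕ.m≤n+m (suc d) m) (ℕ.≤-reflexive (cong ℕ.pred M+D≡X))

fibBound-p₀ : ∀ n → FibBound (p 0) 1 (suc n)
fibBound-p₀ zero          = ℕ.≤-refl
fibBound-p₀ (suc zero)    = ℕ.≤-refl
fibBound-p₀ (suc (suc n)) = z≤n

fibBound-even : ∀ m → odd? m ≡ false → ∀ n → FibBound (p m) (suc m) (suc n)
fibBound-even zero          _    = fibBound-p₀
fibBound-even (suc (suc m)) even n =
  fibBound-cong {c = suc (suc (suc m))} (sym ∘ p-suc-even (suc m) even) (suc n)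
    (AddPart.fibBound {p (suc m)} {p m} (p-suc-odd m (odd?-suc-even m even)) ℕ.≤-refl
                          (fibBound-even m even) n)

q-fib : ∀ n → q (suc (suc n)) ≤ℕ q (suc n) + q n
q-fib n = begin
  q N                       ≡⟨ p-stable N≤M ⟨
  p M N                     ≤⟨ ℕ.m≤m+n _ _ ⟩
  p M N + correction (suc M) N ≤⟨ fibBound-even M (odd?-double N) (suc n) ⟩
  p M (suc n) + p M n       ≡⟨ cong₂ _+_ (p-stable (ℕ.≤-trans (ℕ.n≤1+n _) N≤M))
                                         (p-stable (ℕ.≤-trans (ℕ.n≤1+n _)
                                                     (ℕ.≤-trans (ℕ.n≤1+n _) N≤M))) ⟩
  q (suc n) + q n           ∎
  where
  open ℕ.≤-Reasoning
  N = suc (suc n)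
  M = N + N
  N≤M : N ≤ℕ M
  N≤M = ℕ.m≤m+n N N

+-sub-sub-nonpos : ∀ {a b c} → a ≤ℕ b + c → + a - + b - + c ≤ + 0
+-sub-sub-nonpos {a} {b} {c} a≤b+c =
  subst (_≤ + 0) (sym regroup) (ℤ.i≤j⇒i-j≤0 (ℤ.+≤+ a≤b+c))
  where
  regroup : + a - + b - + c ≡ + a - (+ b ℤ.+ + c)
  regroup = trans (ℤ.+-assoc (+ a) (ℤ.- + b) (ℤ.- + c))
                  (cong (ℤ._+_ (+ a)) (sym (ℤ.neg-distrib-+ (+ b) (+ c))))

theorem4 : (n : ℕ) → 1 ≤ℕ n →
    qℤ (+ n) - qℤ (+ n - + 1) - qℤ (+ n - + 2) ≤ + 0
theorem4 (suc zero)    _ = ℤ.≤-refl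
theorem4 (suc (suc n)) _ = +-sub-sub-nonpos {b = q (suc n)} {q n} (q-fib n)
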